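{- Let $c$ be a stroll-nonrepetitive colouring of a graph $G$. Then no lazy stroll in $G$ is repetitively coloured by $c$.
   Context: All graphs are finite, simple and undirected. A walk is a sequence $(v_1,\dots,v_t)$ of vertices with $v_iv_{i+1}$ an edge for each $i$. A stroll is a walk $(v_1,\dots,v_{2t})$ with $v_i\ne v_{t+i}$ for each $i\in\{1,\dots,t\}$. Two vertices touch if they are adjacent or equal; a lazy walk is a sequence $(v_1,\dots,v_t)$ such that $v_i$ and $v_{i+1}$ touch for each $i$. A lazy stroll is a lazy walk $(v_1,\dots,v_{2t})$ with $v_i\neq v_{t+i}$ for each $i\in\{1,\dots,t\}$. Given a colouring $c$, a sequence $(v_1,\dots,v_{2t})$ is repetitively coloured if $c(v_i)=c(v_{t+i})$ for all $i\in\{1,\dots,t\}$. A colouring is stroll-nonrepetitive if no stroll is repetitively coloured. -}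

module Defs where

open import Level using (Level; _⊔_) renaming (suc to lsuc)
open import Data.Nat using (ℕ; suc; _+_)
open import Data.Fin using (Fin; inject₁; suc; _↑ˡ_; _↑ʳ_)
open import Data.Sum using (_⊎_)
open import Relation.Binary.PropositionalEquality using (_≡_)
open import Relation.Nullary using (¬_)

record Graph (n : ℕ) : Set₁ where
  field
    Adj       : Fin n → Fin n → Set
    Adj-sym   : ∀ {u v} → Adj u v → Adj v u
    Adj-irrefl : ∀ {v} → ¬ Adj v v

module _ {n : ℕ} (G : Graph n) where
  open Graph G

  Touch : Fin n → Fin n → Set
  Touch u v = Adj u v ⊎ u ≡ v

  IsWalk : {k : ℕ} → (Fin (suc k) → Fin n) → Set
  IsWalk {k} v = ∀ (i : Fin k) → Adj (v (inject₁ i)) (v (suc i))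

  IsLazyWalk : {k : ℕ} → (Fin (suc k) → Fin n) → Set
  IsLazyWalk {k} v = ∀ (i : Fin k) → Touch (v (inject₁ i)) (v (suc i))

  -- sequences of length 2t with t ≥ 1 are written as  Fin (suc t + suc t) → Fin n;
  -- position i (0-based, i < t) is  i ↑ˡ t  and position t+i is  t ↑ʳ i.
  IsStroll : (t : ℕ) → (Fin (suc t + suc t) → Fin n) → Set
  IsStroll t v = IsWalk v × (∀ (i : Fin (suc t)) → ¬ v (i ↑ˡ suc t) ≡ v (suc t ↑ʳ i))
    where open import Data.Product using (_×_)

  IsLazyStroll : (t : ℕ) → (Fin (suc t + suc t) → Fin n) → Set
  IsLazyStroll t v = IsLazyWalk v × (∀ (i : Fin (suc t)) → ¬ v (i ↑ˡ suc t) ≡ v (suc t ↑ʳ i))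
    where open import Data.Product using (_×_)

module _ {n : ℕ} {c : Level} {C : Set c} where
  RepetitivelyColoured : (col : Fin n → C) (t : ℕ) → (Fin (suc t + suc t) → Fin n) → Set c
  RepetitivelyColoured col t v = ∀ (i : Fin (suc t)) → col (v (i ↑ˡ suc t)) ≡ col (v (suc t ↑ʳ i))

  StrollNonrepetitive : Graph n → (Fin n → C) → Set c
  StrollNonrepetitive G col =
    ∀ (t : ℕ) (v : Fin (suc t + suc t) → Fin n) → IsStroll G t v → ¬ RepetitivelyColoured col t v

-- Take a lazy stroll of half-length T whose two halves have equal colours. If no two
-- consecutive vertices are equal it is a stroll, contradicting the hypothesis. Since an
-- edge is a stroll of length 2, adjacent vertices get different colours, so touching
-- vertices of equal colour are equal; hence a repeated vertex at positions i, i + 1 of one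
-- half forces one at the matching positions of the other half (unless i + 1 is the first
-- position of the second half). Deleting position i in both halves gives a shorter lazy
-- stroll, still repetitively coloured, and we conclude by induction on T.
module Submission where

open import Defs
open import Level using (Level)
open import Data.Nat using (ℕ; suc; _+_)
open import Data.Fin using (Fin)
open import Relation.Nullary using (¬_)

open import Data.Nat using (zero; _≤_; _<_; z≤n; s≤s; _<?_)
open import Data.Nat.Properties
open import Data.Fin using (toℕ; fromℕ<; inject₁; _↑ˡ_; _↑ʳ_) renaming (zero to fzero; suc to fsuc)
open import Data.Fin.Properties using (toℕ<n; toℕ-fromℕ<; fromℕ<-toℕ; toℕ-inject₁; toℕ-↑ˡ; toℕ-↑ʳ)
open import Data.Sum using (_⊎_; inj₁; inj₂)
open import Data.Product using (_×_; _,_; ∃-syntax)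
open import Data.Empty using (⊥-elim)
open import Function using (_∘_; _on_)
open import Relation.Binary using (tri<; tri≈; tri>)
open import Relation.Binary.PropositionalEquality
open import Relation.Nullary using (yes; no; contradiction)

punchIn : ℕ → ℕ → ℕ
punchIn zero    i       = suc i
punchIn (suc p) zero    = zero
punchIn (suc p) (suc i) = suc (punchIn p i)

punchIn-< : ∀ {p i} → i < p → punchIn p i ≡ i
punchIn-< {suc p} {zero}  _         = refl
punchIn-< {suc p} {suc i} (s≤s i<p) = cong suc (punchIn-< i<p)

punchIn-≥ : ∀ {p i} → p ≤ i → punchIn p i ≡ suc i
punchIn-≥ {zero}  {i}     _         = refl
punchIn-≥ {suc p} {suc i} (s≤s p≤i) = cong suc (punchIn-≥ p≤i)

punchIn-+ : ∀ m p i → punchIn (m + p) (m + i) ≡ m + punchIn p i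
punchIn-+ zero    p i = refl
punchIn-+ (suc m) p i = cong suc (punchIn-+ m p i)

punchIn-<-suc : ∀ p {i m} → i < m → punchIn p i < suc m
punchIn-<-suc zero    i<m               = s≤s i<m
punchIn-<-suc (suc p) {zero}  _         = s≤s z≤n
punchIn-<-suc (suc p) {suc i} (s≤s i<m) = s≤s (punchIn-<-suc p i<m)

module _ {a} {A : Set a} where

  Chain : ∀ {r} → (A → A → Set r) → ℕ → (ℕ → A) → Set r
  Chain R N f = ∀ k → suc k < N → R (f k) (f (suc k))

  Paired : ∀ {r} → (A → A → Set r) → ℕ → (ℕ → A) → Set r
  Paired R T f = ∀ i → i < T → R (f i) (f (T + i))

  -- Deletes the terms at positions p and suc T + p, i.e. position p of both halves of
  -- a sequence of half-length suc T.
  dropPair : ℕ → ℕ → (ℕ → A) → ℕ → A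
  dropPair T p f = f ∘ punchIn p ∘ punchIn (T + p)

  module _ {r} {R : A → A → Set r} where

    Chain-≤ : ∀ {N M f} → N ≤ M → Chain R M f → Chain R N f
    Chain-≤ N≤M chain k sk<N = chain k (<-≤-trans sk<N N≤M)

    Chain-+ : ∀ m {N f} → Chain R (m + N) f → Chain R N (λ i → f (m + i))
    Chain-+ m {N} {f} chain k sk<N =
      subst (R (f (m + k)) ∘ f) (sym (+-suc m k))
        (chain (m + k) (subst (_< m + N) (+-suc m k) (+-monoʳ-< m sk<N)))

    Chain-punchIn : ∀ {N f p} → Chain R (suc N) f → (suc p < suc N → f p ≡ f (suc p)) →
                    Chain R N (f ∘ punchIn p)
    Chain-punchIn {p = p} chain dup k sk<N with <-cmp (suc k) p
    ... | tri< sk<p _ _ rewrite punchIn-< sk<p | punchIn-< (<-trans (n<1+n k) sk<p) =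
      chain k (m<n⇒m<1+n sk<N)
    ... | tri≈ _ refl _ rewrite punchIn-< (n<1+n k) | punchIn-≥ (≤-refl {suc k}) =
      subst (R _) (dup (s≤s sk<N)) (chain k (m<n⇒m<1+n sk<N))
    ... | tri> _ _ p<sk rewrite punchIn-≥ (≤-pred p<sk) | punchIn-≥ (<⇒≤ p<sk) =
      chain (suc k) (s≤s sk<N)

    Chain-dropPair : ∀ {T p f} → Chain R (suc T + suc T) f →
                     f p ≡ f (suc p) → (suc p < suc T → f (suc T + p) ≡ f (suc T + suc p)) →
                     Chain R (T + T) (dropPair T p f)
    Chain-dropPair {T} {p} {f} chain dup₁ dup₂ =
      Chain-punchIn (Chain-≤ (≤-reflexive (sym (+-suc T T))) (Chain-punchIn chain (λ _ → dup₁))) dup₂′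
      where
      dup₂′ : suc (T + p) < suc (T + T) → f (punchIn p (T + p)) ≡ f (punchIn p (suc (T + p)))
      dup₂′ lt rewrite punchIn-≥ (m≤n+m p T) | punchIn-≥ (m≤n+m p (suc T)) =
        trans (dup₂ (s≤s (+-cancelˡ-< T p T (≤-pred lt)))) (cong f (+-suc (suc T) p))

    Paired-dropPair : ∀ {T p f} → p ≤ T → Paired R (suc T) f → Paired R T (dropPair T p f)
    Paired-dropPair {T} {p} p≤T paired i i<T
      rewrite punchIn-< (<-≤-trans i<T (m≤m+n T p))
            | punchIn-+ T p i
            | punchIn-≥ (≤-trans p≤T (m≤m+n T (punchIn p i))) =
      paired (punchIn p i) (punchIn-<-suc p i<T)

  Chain-⊎ : ∀ {p q} (P : A → A → Set p) (Q : A → A → Set q) N f →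
            Chain (λ x y → P x y ⊎ Q x y) N f → Chain P N f ⊎ ∃[ k ] suc k < N × Q (f k) (f (suc k))
  Chain-⊎ P Q zero          _ _     = inj₁ λ _ ()
  Chain-⊎ P Q (suc zero)    _ _     = inj₁ λ { _ (s≤s ()) }
  Chain-⊎ P Q (suc (suc N)) f chain
    with chain 0 (s≤s (s≤s z≤n)) | Chain-⊎ P Q (suc N) (f ∘ suc) (λ k → chain (suc k) ∘ s≤s)
  ... | inj₂ q₀ | _                  = inj₂ (0 , s≤s (s≤s z≤n) , q₀)
  ... | inj₁ _  | inj₂ (k , sk< , q) = inj₂ (suc k , s≤s sk< , q)
  ... | inj₁ p₀ | inj₁ chain′        = inj₁ λ { zero _ → p₀ ; (suc k) (s≤s sk<) → chain′ k sk< }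

  -- Past the end of v the value v zero is an arbitrary filler.
  extend : ∀ {m} → (Fin (suc m) → A) → ℕ → A
  extend {m} v k with k <? suc m
  ... | yes k<m = v (fromℕ< k<m)
  ... | no _    = v fzero

  extend-toℕ : ∀ {m} (v : Fin (suc m) → A) {k} (x : Fin (suc m)) → toℕ x ≡ k → v x ≡ extend v k
  extend-toℕ {m} v x refl with toℕ x <? suc m
  ... | yes x<m = cong v (sym (fromℕ<-toℕ x x<m))
  ... | no x≮m  = contradiction (toℕ<n x) x≮m

  module _ {r} {R : A → A → Set r} where

    Chain⇒Fin : ∀ {m f} → Chain R (suc m) f → ∀ (i : Fin m) → R (f (toℕ (inject₁ i))) (f (suc (toℕ i)))
    Chain⇒Fin chain i rewrite toℕ-inject₁ i = chain (toℕ i) (s≤s (toℕ<n i))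

    Paired⇒Fin : ∀ {t f} → Paired R (suc t) f →
                 ∀ (i : Fin (suc t)) → R (f (toℕ (i ↑ˡ suc t))) (f (toℕ (suc t ↑ʳ i)))
    Paired⇒Fin {t} paired i rewrite toℕ-↑ˡ i (suc t) | toℕ-↑ʳ (suc t) i = paired (toℕ i) (toℕ<n i)

    extend-Chain : ∀ {m} {v : Fin (suc m) → A} →
                   (∀ (i : Fin m) → R (v (inject₁ i)) (v (fsuc i))) → Chain R (suc m) (extend v)
    extend-Chain {v = v} steps k (s≤s k<m) =
      subst₂ R (extend-toℕ v _ (trans (toℕ-inject₁ i) (toℕ-fromℕ< k<m)))
               (extend-toℕ v _ (cong suc (toℕ-fromℕ< k<m))) (steps i)
      where i = fromℕ< k<m

    extend-Paired : ∀ {t} {v : Fin (suc t + suc t) → A} →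
                    (∀ (i : Fin (suc t)) → R (v (i ↑ˡ suc t)) (v (suc t ↑ʳ i))) → Paired R (suc t) (extend v)
    extend-Paired {t} {v} pairs k k<T =
      subst₂ R (extend-toℕ v _ (trans (toℕ-↑ˡ i (suc t)) (toℕ-fromℕ< k<T)))
               (extend-toℕ v _ (trans (toℕ-↑ʳ (suc t) i) (cong (suc t +_) (toℕ-fromℕ< k<T)))) (pairs i)
      where i = fromℕ< k<T

module _ {n ℓ} {C : Set ℓ} (G : Graph n) (col : Fin n → C) (nonrep : StrollNonrepetitive G col) where
  open Graph G

  stroll-not-repetitive : ∀ t f → Chain Adj (suc t + suc t) f → Paired _≢_ (suc t) f →
                          ¬ Paired (_≡_ on col) (suc t) f
  stroll-not-repetitive t f walk distinct rep =
    nonrep t (f ∘ toℕ) (Chain⇒Fin {R = Adj} walk , Paired⇒Fin {R = _≢_} distinct)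
      (Paired⇒Fin {R = _≡_ on col} rep)

  adjacent-colours-differ : ∀ {u w} → Adj u w → col u ≢ col w
  adjacent-colours-differ {u} {w} u~w same =
    stroll-not-repetitive 0 edge
      (λ { zero _ → u~w ; (suc _) (s≤s (s≤s ())) })
      (λ { zero _ u≡w → Adj-irrefl (subst (λ x → Adj x w) u≡w u~w) ; (suc _) (s≤s ()) })
      (λ { zero _ → same ; (suc _) (s≤s ()) })
    where
    edge : ℕ → Fin n
    edge zero    = u
    edge (suc _) = w

  touching-same-colour⇒≡ : ∀ {u w} → Touch G u w → col u ≡ col w → u ≡ w
  touching-same-colour⇒≡ (inj₁ u~w) same = ⊥-elim (adjacent-colours-differ u~w same)
  touching-same-colour⇒≡ (inj₂ u≡w) _    = u≡w

  repeat-transfers : ∀ {u u′ w w′} → Touch G w w′ → col u ≡ col w → col u′ ≡ col w′ → u ≡ u′ → w ≡ w′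
  repeat-transfers w~w′ cu cu′ refl = touching-same-colour⇒≡ w~w′ (trans (sym cu) cu′)

  module _ {T f} (lazy : Chain (Touch G) (T + T) f) (rep : Paired (_≡_ on col) T f) where

    first-half-repeat⇒second : ∀ {i} → suc i < T → f i ≡ f (suc i) → f (T + i) ≡ f (T + suc i)
    first-half-repeat⇒second {i} si<T =
      repeat-transfers (Chain-+ {R = Touch G} T lazy i si<T)
        (rep i (<-trans (n<1+n i) si<T)) (rep (suc i) si<T)

    second-half-repeat⇒first : ∀ {i} → suc i < T → f (T + i) ≡ f (T + suc i) → f i ≡ f (suc i)
    second-half-repeat⇒first {i} si<T =
      repeat-transfers (Chain-≤ {R = Touch G} (m≤m+n T T) lazy i si<T)
        (sym (rep i (<-trans (n<1+n i) si<T))) (sym (rep (suc i) si<T))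

    repeat-in-both-halves : ∀ k → suc k < T + T → f k ≡ f (suc k) →
                            ∃[ p ] p < T × f p ≡ f (suc p) × (suc p < T → f (T + p) ≡ f (T + suc p))
    repeat-in-both-halves k sk<2T e with <-cmp (suc k) T
    ... | tri< sk<T _ _ = k , <-trans (n<1+n k) sk<T , e , λ _ → first-half-repeat⇒second sk<T e
    ... | tri≈ _ sk≡T _ = k , ≤-reflexive sk≡T , e , λ sk<T → contradiction sk≡T (<⇒≢ sk<T)
    ... | tri> _ _ T<sk with m≤n⇒∃[o]m+o≡n (≤-pred T<sk)
    ...   | j , refl = j , <-trans (n<1+n j) sj<T , second-half-repeat⇒first sj<T e′ , λ _ → e′
      where
      e′ : f (T + j) ≡ f (T + suc j)
      e′ = trans e (cong f (sym (+-suc T j)))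
      sj<T : suc j < T
      sj<T = +-cancelˡ-< T (suc j) T (subst (_< T + T) (sym (+-suc T j)) sk<2T)

  lazy-stroll-not-repetitive : ∀ t f → Chain (Touch G) (suc t + suc t) f → Paired _≢_ (suc t) f →
                               ¬ Paired (_≡_ on col) (suc t) f
  lazy-stroll-not-repetitive t f lazy distinct rep with Chain-⊎ Adj _≡_ _ f lazy
  ... | inj₁ walk = stroll-not-repetitive t f walk distinct rep
  ... | inj₂ (k , sk<2T , e) with repeat-in-both-halves lazy rep k sk<2T e
  lazy-stroll-not-repetitive zero    f lazy distinct rep | inj₂ _ | _ , s≤s z≤n , e₁ , _ =
    distinct 0 (s≤s z≤n) e₁
  lazy-stroll-not-repetitive (suc t) f lazy distinct rep | inj₂ _ | p , p<T , e₁ , e₂ =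
    lazy-stroll-not-repetitive t (dropPair (suc t) p f)
      (Chain-dropPair {R = Touch G} lazy e₁ e₂)
      (Paired-dropPair {R = _≢_} p≤T distinct) (Paired-dropPair {R = _≡_ on col} p≤T rep)
    where p≤T = ≤-pred p<T

lemma10 : ∀ {n : ℕ} {ℓ : Level} {C : Set ℓ} (G : Graph n) (col : Fin n → C) →
    StrollNonrepetitive G col →
    ∀ (t : ℕ) (v : Fin (suc t + suc t) → Fin n) →
    IsLazyStroll G t v → ¬ RepetitivelyColoured col t v
lemma10 G col nonrep t v (lazy , distinct) rep =
  lazy-stroll-not-repetitive G col nonrep t (extend v)
    (extend-Chain {R = Touch G} lazy)
    (extend-Paired {R = _≢_} distinct) (extend-Paired {R = _≡_ on col} rep)
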